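{- Let $G$ be a finite graph and $H=(V_H,E_H)$ an isometric subgraph of $G$ (i.e. $d_H(u,v)=d_G(u,v)$ for all $u,v\in V_H$) with $|\partial(V_H)|=1$. Then every lion strategy that clears $G$ has a time step $t$ at which at least $\mathcal{L}(H)$ lions are located in $V_H$ (i.e. at least $\mathcal{L}(H)$ indices $i$ satisfy $p_i(t)\in V_H$).
   Context: Lions and contamination game on a finite graph $G=(V,E)$. For $S\subseteq V$, $N(S)=\{w\in V\setminus S:\exists v\in S,\{v,w\}\in E\}$ and the boundary $\partial(S)=\{w\in S: w\text{ has a neighbour in }N(S)\}$; $N(v)=N(\{v\})$. A lion strategy with $k\ge1$ lions: initial positions $p_i(0)$, and $p_i(t)\in\{p_i(t-1)\}\cup N(p_i(t-1))$ for $t\ge1$; $L_t=\{p_i(t)\}_i$, $\pi_t=\{(p_i(t-1),p_i(t))\}_i$. Contaminated sets: $W_0=V\setminus L_0$; $W_t=(W_{t-1}\setminus L_t)\cup\{v\in V\setminus L_t:\exists w\in W_{t-1}\cap N(v),\ (v,w)\notin\pi_t,(w,v)\notin\pi_t\}$. The strategy clears $G$ if $W_T=\emptyset$ for some $T$; $\mathcal{L}(H)$ is the minimum number of lions of a strategy clearing $H$ (played on $H$ alone). -}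

module Defs where

open import Data.Nat using (ℕ; zero; suc; _≤_)
open import Data.Fin using (Fin)
open import Data.Bool using (Bool; true; false; T; if_then_else_)
open import Data.List using (List; map)
open import Data.Nat.ListAction using (sum)
open import Data.Product using (Σ; ∃; _×_; _,_; proj₁)
open import Data.Sum using (_⊎_)
open import Relation.Nullary using (¬_)
open import Relation.Binary.PropositionalEquality using (_≡_)
open import Data.List using (allFin) public

record Graph : Set₁ where
  field
    V : Set
    E : V → V → Set
open Graph public

-- Walks and graph distance.  Dist Γ u v k  means  d_Γ(u,v) = k
-- (a walk of length k exists, and every walk has length ≥ k).
-- If u,v are in different components no k satisfies it (distance ∞).

data Walk (Γ : Graph) : V Γ → V Γ → ℕ → Set where
  nil  : ∀ {u} → Walk Γ u u 0
  cons : ∀ {u w v l} → E Γ u w → Walk Γ w v l → Walk Γ u v (suc l)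

Dist : (Γ : Graph) → V Γ → V Γ → ℕ → Set
Dist Γ u v k = Walk Γ u v k × (∀ j → Walk Γ u v j → k ≤ j)

record Strategy (Γ : Graph) (k : ℕ) : Set where
  field
    pos   : ℕ → Fin k → V Γ
    moves : ∀ t i → (pos (suc t) i ≡ pos t i) ⊎ E Γ (pos t i) (pos (suc t) i)
open Strategy public

Contaminated : {Γ : Graph} {k : ℕ} → Strategy Γ k → ℕ → V Γ → Set
Contaminated {Γ} {k} σ zero v = ¬ (∃ λ (i : Fin k) → pos σ 0 i ≡ v)
Contaminated {Γ} {k} σ (suc t) v =
  ¬ (∃ λ (i : Fin k) → pos σ (suc t) i ≡ v) ×
  ( Contaminated σ t v
  ⊎ Σ (V Γ) (λ w → Contaminated σ t w × E Γ v w
      × ¬ (∃ λ (i : Fin k) → pos σ t i ≡ v × pos σ (suc t) i ≡ w)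
      × ¬ (∃ λ (i : Fin k) → pos σ t i ≡ w × pos σ (suc t) i ≡ v)))

Clears : {Γ : Graph} {k : ℕ} → Strategy Γ k → Set
Clears {Γ} σ = ∃ λ (T : ℕ) → ∀ (v : V Γ) → ¬ Contaminated σ T v

IsLionNumber : Graph → ℕ → Set
IsLionNumber Γ ℓ =
  (1 ≤ ℓ × Σ (Strategy Γ ℓ) Clears) ×
  (∀ k → 1 ≤ k → (σ : Strategy Γ k) → Clears σ → ℓ ≤ k)

record FinGraph : Set where
  field
    n     : ℕ
    adj   : Fin n → Fin n → Bool
    sym   : ∀ u v → adj u v ≡ adj v u
    irrefl : ∀ v → adj v v ≡ false
open FinGraph public

asGraph : FinGraph → Graph
asGraph G = record { V = Fin (n G) ; E = λ u v → T (adj G u v) }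

record Subgraph (G : FinGraph) : Set where
  field
    VH    : Fin (n G) → Bool
    EH    : Fin (n G) → Fin (n G) → Bool
    EH-sym : ∀ u v → EH u v ≡ EH v u
    EH⊆   : ∀ u v → T (EH u v) → T (VH u) × T (VH v) × T (adj G u v)
open Subgraph public

subGraph : {G : FinGraph} → Subgraph G → Graph
subGraph {G} H = record
  { V = Σ (Fin (n G)) (λ v → T (VH H v))
  ; E = λ u v → T (EH H (proj₁ u) (proj₁ v)) }

-- Isometric: d_H(u,v) = d_G(u,v) for all u,v ∈ V_H (including ∞).
Isometric : {G : FinGraph} → Subgraph G → Set
Isometric {G} H = ∀ u v (hu : T (VH H u)) (hv : T (VH H v)) (k : ℕ) →
  (Dist (subGraph H) (u , hu) (v , hv) k → Dist (asGraph G) u v k) ×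
  (Dist (asGraph G) u v k → Dist (subGraph H) (u , hu) (v , hv) k)

InBoundary : {G : FinGraph} → Subgraph G → Fin (n G) → Set
InBoundary {G} H w = T (VH H w) ×
  (∃ λ x → T (adj G w x) × VH H x ≡ false)

BoundarySize1 : {G : FinGraph} → Subgraph G → Set
BoundarySize1 H = ∃ λ x → InBoundary H x × (∀ w → InBoundary H w → w ≡ x)

lionsIn : {G : FinGraph} {k : ℕ} → Subgraph G → Strategy (asGraph G) k → ℕ → ℕ
lionsIn {G} {k} H σ t =
  sum (map (λ i → if VH H (pos σ t i) then 1 else 0) (allFin k))

module Submission where

-- Let x be the unique vertex of ∂(V_H). A lion can enter or leave V_H only through x and,
-- H being isometric, every edge of G between vertices of V_H is an edge of H. Hence the
-- retraction of G onto V_H sending every outside vertex to x maps lion moves of G to lion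
-- moves of H. Let m be the largest number of lions of a clearing strategy σ in V_H up to its
-- clearing time. A register of m slots assigns the lions of σ in V_H to m lions of H, the lion
-- of an empty slot waiting at x; as slots change hands only at x, this is a strategy on H.
-- It occupies every vertex of V_H that σ occupies and repeats every move of σ inside V_H, so
-- its contaminated set stays within that of σ and it clears H. Thus 𝓛(H) ≤ m.

open import Defs hiding (sym)
open import Data.Nat using (ℕ; zero; suc; _≤_; _⊔_; z≤n; s≤s)
open import Data.Nat.Properties
  using (≤-refl; ≤-trans; n≤1+n; m≤n+m; <⇒≱; m≤m⊔n; m≤n⊔m; ⊔-sel; m≤n⇒m<n∨m≡n)
open import Data.Fin using (Fin; zero; suc; punchIn; punchOut)
open import Data.Fin.Properties
  using (any?; punchIn-injective; punchInᵢ≢i; punchOut-injective; punchIn-punchOut)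
  renaming (_≟_ to _≟ᶠ_)
open import Data.Maybe using (Maybe; just; nothing)
open import Data.Maybe.Properties using (just-injective; ≡-dec)
open import Data.Bool using (Bool; true; false; T; if_then_else_)
open import Data.Bool.Properties using (T-irrelevant)
open import Data.Unit using (tt)
open import Data.Empty using (⊥-elim)
open import Data.List using (List; []; _∷_; tabulate)
open import Data.List.Properties using (map-tabulate)
open import Data.List.Relation.Unary.All using (All; []; _∷_) renaming (lookup to All-lookup)
open import Data.List.Membership.Propositional.Properties using (∈-allFin)
open import Data.Nat.ListAction using (sum)
open import Data.Vec using (Vec; []; _∷_; lookup; replicate; map)
open import Data.Vec.Properties using (lookup-map; lookup-replicate)
open import Data.Product using (∃; _×_; _,_; proj₁; proj₂)
open import Data.Sum using (_⊎_; inj₁; inj₂)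
open import Function using (_∘_)
open import Function.Definitions using (Injective)
open import Relation.Nullary using (¬_; Dec; yes; no)
open import Relation.Nullary.Decidable using (⌊_⌋; toWitness; fromWitness; T?)
open import Relation.Binary using (DecidableEquality)
open import Relation.Binary.PropositionalEquality

count : ∀ {k} → (Fin k → Bool) → ℕ
count Q = sum (tabulate (λ i → if Q i then 1 else 0))

≤-count : ∀ {n k} (Q : Fin k → Bool) (f : Fin n → Fin k) →
  Injective _≡_ _≡_ f → (∀ a → T (Q (f a))) → n ≤ count Q

≤-count-tail : ∀ {n k} (Q : Fin (suc k) → Bool) (f : Fin n → Fin (suc k)) →
  Injective _≡_ _≡_ f → (∀ a → T (Q (f a))) → (∀ a → zero ≢ f a) → n ≤ count (Q ∘ suc)
≤-count-tail Q f inj sat f≢0 =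
  ≤-count (Q ∘ suc) (λ a → punchOut (f≢0 a))
    (λ e → inj (punchOut-injective (f≢0 _) (f≢0 _) e))
    (λ a → subst (T ∘ Q) (sym (punchIn-punchOut (f≢0 a))) (sat a))

≤-count {zero} Q f inj sat = z≤n
≤-count {suc n} {zero} Q f inj sat with f zero
... | ()
≤-count {n} {suc k} Q f inj sat with any? (λ a → f a ≟ᶠ zero)
... | no ¬hit = ≤-trans (≤-count-tail Q f inj sat (λ a e → ¬hit (a , sym e))) (m≤n+m _ _)
≤-count {suc n} {suc k} Q f inj sat | yes (a₀ , fa₀≡0)
  with Q zero | subst (T ∘ Q) fa₀≡0 (sat a₀)
... | true | _ = s≤s (≤-count-tail Q (f ∘ punchIn a₀) (punchIn-injective a₀ _ _ ∘ inj)
                       (sat ∘ punchIn a₀)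
                       (λ a e → punchInᵢ≢i a₀ a (inj (trans (sym e) (sym fa₀≡0)))))

T⇒1≤count : ∀ {k} (Q : Fin k → Bool) {i} → T (Q i) → 1 ≤ count Q
T⇒1≤count Q {i} qi = ≤-count Q (λ _ → i) (λ { {zero} {zero} _ → refl }) (λ _ → qi)

maxUpTo : (ℕ → ℕ) → ℕ → ℕ
maxUpTo f zero = f zero
maxUpTo f (suc t) = maxUpTo f t ⊔ f (suc t)

≤-maxUpTo : ∀ f {t u} → t ≤ u → f t ≤ maxUpTo f u
≤-maxUpTo f {u = zero} z≤n = ≤-refl
≤-maxUpTo f {t} {suc u} t≤ with m≤n⇒m<n∨m≡n t≤
... | inj₁ (s≤s t≤u) = ≤-trans (≤-maxUpTo f t≤u) (m≤m⊔n _ _)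
... | inj₂ refl = m≤n⊔m _ _

maxUpTo-attained : ∀ f u → ∃ λ t → maxUpTo f u ≡ f t
maxUpTo-attained f zero = zero , refl
maxUpTo-attained f (suc u) with ⊔-sel (maxUpTo f u) (f (suc u))
... | inj₁ e = let t , e′ = maxUpTo-attained f u in t , trans e e′
... | inj₂ e = suc u , e

¬T⇒≡false : ∀ {b} → ¬ T b → b ≡ false
¬T⇒≡false {true} ¬t = ⊥-elim (¬t tt)
¬T⇒≡false {false} _ = refl

module Registers {k : ℕ} where

  -- Slot j holds the lion of G that the j-th lion of H follows, if any.
  Register : ℕ → Set
  Register m = Vec (Maybe (Fin k)) m

  private variable
    m : ℕ
    i : Fin k
    j : Fin m
    s s′ s″ : Register m
    P : Fin k → Set
    p Q : Fin k → Bool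

  _∈ᴿ_ : Fin k → Register m → Set
  i ∈ᴿ s = ∃ λ j → lookup s j ≡ just i

  _∈ᴿ?_ : (i : Fin k) (s : Register m) → Dec (i ∈ᴿ s)
  i ∈ᴿ? s = any? (λ j → ≡-dec _≟ᶠ_ (lookup s j) (just i))

  Full : Register m → Set
  Full s = ∀ j → ∃ λ i → lookup s j ≡ just i

  Unique : Register m → Set
  Unique s = ∀ {i j j′} → lookup s j ≡ just i → lookup s j′ ≡ just i → j ≡ j′

  AllSatisfy : (Fin k → Bool) → Register m → Set
  AllSatisfy Q s = ∀ {i j} → lookup s j ≡ just i → T (Q i)

  SlotFill : (Fin k → Set) → Maybe (Fin k) → Maybe (Fin k) → Set
  SlotFill P c c′ = c′ ≡ c ⊎ (c ≡ nothing × ∃ λ i → P i × c′ ≡ just i)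

  SlotFill-trans : ∀ {c c′ c″} → SlotFill P c c′ → SlotFill P c′ c″ → SlotFill P c c″
  SlotFill-trans (inj₁ e) (inj₁ e′) = inj₁ (trans e′ e)
  SlotFill-trans (inj₁ e) (inj₂ (free , i , p , e′)) = inj₂ (trans (sym e) free , i , p , e′)
  SlotFill-trans (inj₂ (free , i , p , e)) (inj₁ e′) = inj₂ (free , i , p , trans e′ e)
  SlotFill-trans (inj₂ (_ , _ , _ , e)) (inj₂ (free , _)) with () ← trans (sym e) free

  record FillsFree (P : Fin k → Set) (s s′ : Register m) : Set where
    constructor fills
    field
      slot : ∀ j → SlotFill P (lookup s j) (lookup s′ j)
  open FillsFree

  FillsFree-refl : FillsFree P s s
  FillsFree-refl = fills λ _ → inj₁ refl

  FillsFree-trans : FillsFree P s s′ → FillsFree P s′ s″ → FillsFree P s s″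
  FillsFree-trans f g = fills λ j → SlotFill-trans (slot f j) (slot g j)

  FillsFree-keep : FillsFree P s s′ → lookup s j ≡ just i → lookup s′ j ≡ just i
  FillsFree-keep {j = j} f l with slot f j
  ... | inj₁ e = trans e l
  ... | inj₂ (free , _) with () ← trans (sym l) free

  FillsFree-invisible : ∀ {A : Set} (g : Maybe (Fin k) → A) →
    (∀ {i} → P i → g (just i) ≡ g nothing) →
    FillsFree P s s′ → ∀ j → g (lookup s′ j) ≡ g (lookup s j)
  FillsFree-invisible g inv f j with slot f j
  ... | inj₁ e = cong g e
  ... | inj₂ (free , i , p , e) = trans (cong g e) (trans (inv p) (cong g (sym free)))

  FillsFree-satisfies : (∀ {i} → P i → T (Q i)) →
    FillsFree P s s′ → AllSatisfy Q s → AllSatisfy Q s′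
  FillsFree-satisfies {Q = Q} P⇒Q f sat {j = j} l with slot f j
  ... | inj₁ e = sat (trans (sym e) l)
  ... | inj₂ (_ , i , p , e) = subst (T ∘ Q) (just-injective (trans (sym e) l)) (P⇒Q p)

  empty : Register m
  empty = replicate _ nothing

  empty-unique : ∀ {m} → Unique (empty {m})
  empty-unique {j = j} l with () ← trans (sym (lookup-replicate j nothing)) l

  empty-satisfies : ∀ {m Q} → AllSatisfy Q (empty {m})
  empty-satisfies {j = j} l with () ← trans (sym (lookup-replicate j nothing)) l

  insert : Fin k → Register m → Register m
  insert i [] = []
  insert i (nothing ∷ s) = just i ∷ s
  insert i (just a ∷ s) = just a ∷ insert i s

  insert-fills : P i → (s : Register m) → FillsFree P s (insert i s)
  insert-fills p s = fills (insert-slot p s)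
    where
    insert-slot : P i → (s : Register m) → ∀ j → SlotFill P (lookup s j) (lookup (insert i s) j)
    insert-slot p (nothing ∷ s) zero = inj₂ (refl , _ , p , refl)
    insert-slot p (just a ∷ s) zero = inj₁ refl
    insert-slot p (nothing ∷ s) (suc j) = inj₁ refl
    insert-slot p (just a ∷ s) (suc j) = insert-slot p s j

  insert-fills-once : ∀ (s : Register m) {j j′} →
    lookup s j ≡ nothing → lookup (insert i s) j ≡ just i →
    lookup s j′ ≡ nothing → lookup (insert i s) j′ ≡ just i → j ≡ j′
  insert-fills-once (nothing ∷ s) {zero} {zero} _ _ _ _ = refl
  insert-fills-once (nothing ∷ s) {zero} {suc j′} _ _ free e with () ← trans (sym free) e
  insert-fills-once (nothing ∷ s) {suc j} free e _ _ with () ← trans (sym free) e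
  insert-fills-once (just a ∷ s) {suc j} {suc j′} free e free′ e′ =
    cong suc (insert-fills-once s free e free′ e′)

  insert-unique : (s : Register m) → ¬ i ∈ᴿ s → Unique s → Unique (insert i s)
  insert-unique {i = i} s i∉s u {j = j} {j′} e e′
    with slot (insert-fills {P = _≡ i} refl s) j | slot (insert-fills {P = _≡ i} refl s) j′
  ... | inj₁ x | inj₁ y = u (trans (sym x) e) (trans (sym y) e′)
  ... | inj₁ x | inj₂ (_ , _ , refl , y) =
    ⊥-elim (i∉s (j , trans (trans (sym x) e) (trans (sym e′) y)))
  ... | inj₂ (_ , _ , refl , x) | inj₁ y =
    ⊥-elim (i∉s (j′ , trans (trans (sym y) e′) (trans (sym e) x)))
  ... | inj₂ (free , _ , refl , x) | inj₂ (free′ , _ , refl , y) =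
    insert-fills-once s free x free′ y

  insert-∈ : (i : Fin k) (s : Register m) → i ∈ᴿ insert i s ⊎ Full s
  insert-∈ i [] = inj₂ λ ()
  insert-∈ i (nothing ∷ s) = inj₁ (zero , refl)
  insert-∈ i (just a ∷ s) with insert-∈ i s
  ... | inj₁ (j , e) = inj₁ (suc j , e)
  ... | inj₂ full = inj₂ λ { zero → a , refl ; (suc j) → full j }

  track : (Fin k → Bool) → Fin k → Register m → Register m
  track p i s with p i | i ∈ᴿ? s
  ... | true | no _ = insert i s
  ... | _ | _ = s

  track-fills : (p : Fin k → Bool) (i : Fin k) (s : Register m) → FillsFree (T ∘ p) s (track p i s)
  track-fills p i s with p i in pi | i ∈ᴿ? s
  ... | true | no _ = insert-fills (subst T (sym pi) tt) s
  ... | true | yes _ = FillsFree-refl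
  ... | false | _ = FillsFree-refl

  track-unique : (p : Fin k → Bool) (i : Fin k) (s : Register m) → Unique s → Unique (track p i s)
  track-unique p i s u with p i | i ∈ᴿ? s
  ... | true | no i∉s = insert-unique s i∉s u
  ... | true | yes _ = u
  ... | false | _ = u

  track-∈ : (p : Fin k → Bool) (i : Fin k) (s : Register m) → T (p i) →
    i ∈ᴿ track p i s ⊎ (Full s × ¬ i ∈ᴿ s)
  track-∈ p i s pi with p i | i ∈ᴿ? s
  ... | true | yes i∈s = inj₁ i∈s
  ... | true | no i∉s with insert-∈ i s
  ...   | inj₁ i∈s = inj₁ i∈s
  ...   | inj₂ full = inj₂ (full , i∉s)

  full-count : (s : Register m) → Full s → Unique s → AllSatisfy Q s → ¬ i ∈ᴿ s → T (Q i) →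
    suc m ≤ count Q
  full-count {m = m} {Q = Q} {i = i} s full u sat i∉s qi =
    ≤-count Q lion lion-injective lion-satisfies
    where
    lion : Fin (suc m) → Fin k
    lion zero = i
    lion (suc j) = proj₁ (full j)
    lion-injective : Injective _≡_ _≡_ lion
    lion-injective {zero} {zero} _ = refl
    lion-injective {zero} {suc b} e = ⊥-elim (i∉s (b , trans (proj₂ (full b)) (cong just (sym e))))
    lion-injective {suc a} {zero} e = ⊥-elim (i∉s (a , trans (proj₂ (full a)) (cong just e)))
    lion-injective {suc a} {suc b} e =
      cong suc (u (proj₂ (full a)) (trans (proj₂ (full b)) (cong just (sym e))))
    lion-satisfies : ∀ a → T (Q (lion a))
    lion-satisfies zero = qi
    lion-satisfies (suc j) = sat (proj₂ (full j))

  trackList : (Fin k → Bool) → List (Fin k) → Register m → Register m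
  trackList p [] s = s
  trackList p (i ∷ is) s = trackList p is (track p i s)

  trackList-fills : ∀ p is (s : Register m) → FillsFree (T ∘ p) s (trackList p is s)
  trackList-fills p [] s = FillsFree-refl
  trackList-fills p (i ∷ is) s = FillsFree-trans (track-fills p i s) (trackList-fills p is _)

  trackList-unique : ∀ p is (s : Register m) → Unique s → Unique (trackList p is s)
  trackList-unique p [] s u = u
  trackList-unique p (i ∷ is) s u = trackList-unique p is _ (track-unique p i s u)

  trackList-covers : ∀ p is (s : Register m) → (∀ {i} → T (p i) → T (Q i)) →
    AllSatisfy Q s → Unique s → count Q ≤ m → All (λ i → T (p i) → i ∈ᴿ trackList p is s) is
  trackList-covers p [] s p⇒Q sat u bound = []
  trackList-covers p (i ∷ is) s p⇒Q sat u bound =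
    head ∷ trackList-covers p is (track p i s) p⇒Q
             (FillsFree-satisfies p⇒Q (track-fills p i s) sat) (track-unique p i s u) bound
    where
    head : T (p i) → i ∈ᴿ trackList p is (track p i s)
    head pi with track-∈ p i s pi
    ... | inj₁ (j , e) = j , FillsFree-keep (trackList-fills p is _) e
    ... | inj₂ (full , i∉s) = ⊥-elim (<⇒≱ (full-count s full u sat i∉s (p⇒Q pi)) bound)

  trackAll : (Fin k → Bool) → Register m → Register m
  trackAll p = trackList p (allFin k)

  trackAll-covers : ∀ p (s : Register m) → (∀ {i} → T (p i) → T (Q i)) →
    AllSatisfy Q s → Unique s → count Q ≤ m → T (p i) → i ∈ᴿ trackAll p s
  trackAll-covers {i = i} p s p⇒Q sat u bound =
    All-lookup (trackList-covers p _ s p⇒Q sat u bound) (∈-allFin i)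

  trackAll-fills : ∀ p (s : Register m) → FillsFree (T ∘ p) s (trackAll p s)
  trackAll-fills p = trackList-fills p (allFin k)

  trackAll-unique : ∀ p (s : Register m) → Unique s → Unique (trackAll p s)
  trackAll-unique p = trackList-unique p (allFin k)

  keepIf : (Fin k → Bool) → Maybe (Fin k) → Maybe (Fin k)
  keepIf p nothing = nothing
  keepIf p (just i) = if p i then just i else nothing

  keepIf-just : ∀ p {c : Maybe (Fin k)} → keepIf p c ≡ just i → c ≡ just i × T (p i)
  keepIf-just p {just a} e with p a in pa
  keepIf-just p {just a} refl | true = refl , subst T (sym pa) tt

  keepIf-true : ∀ p → T (p i) → keepIf p (just i) ≡ just i
  keepIf-true {i = i} p pi with p i
  ... | true = refl

  keepIf-invisible : ∀ {A : Set} (g : Maybe (Fin k) → A) p →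
    (∀ {i} → p i ≡ false → g (just i) ≡ g nothing) → ∀ c → g (keepIf p c) ≡ g c
  keepIf-invisible g p inv nothing = refl
  keepIf-invisible g p inv (just i) with p i in pi
  ... | true = refl
  ... | false = sym (inv pi)

  restrict : (Fin k → Bool) → Register m → Register m
  restrict p = map (keepIf p)

  restrict-just : ∀ p (s : Register m) →
    lookup (restrict p s) j ≡ just i → lookup s j ≡ just i × T (p i)
  restrict-just {j = j} p s e = keepIf-just p (trans (sym (lookup-map j (keepIf p) s)) e)

  restrict-keep : ∀ p (s : Register m) →
    lookup s j ≡ just i → T (p i) → lookup (restrict p s) j ≡ just i
  restrict-keep {j = j} p s l pi =
    trans (lookup-map j (keepIf p) s) (trans (cong (keepIf p) l) (keepIf-true p pi))

  restrict-unique : ∀ p (s : Register m) → Unique s → Unique (restrict p s)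
  restrict-unique p s u e e′ = u (proj₁ (restrict-just p s e)) (proj₁ (restrict-just p s e′))

  restrict-satisfies : ∀ p (s : Register m) → AllSatisfy p (restrict p s)
  restrict-satisfies p s e = proj₂ (restrict-just p s e)

  restrict-invisible : ∀ {A : Set} (g : Maybe (Fin k) → A) p →
    (∀ {i} → p i ≡ false → g (just i) ≡ g nothing) →
    (s : Register m) → ∀ j → g (lookup (restrict p s) j) ≡ g (lookup s j)
  restrict-invisible g p inv s j =
    trans (cong g (lookup-map j (keepIf p) s)) (keepIf-invisible g p inv (lookup s j))

Move : (Γ : Graph) → V Γ → V Γ → Set
Move Γ u v = v ≡ u ⊎ E Γ u v

adjacent⇒dist-1 : (G : FinGraph) {u v : Fin (n G)} → T (adj G u v) → Dist (asGraph G) u v 1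
adjacent⇒dist-1 G a = cons a nil , shortest a
  where
  shortest : ∀ {u v} → T (adj G u v) → ∀ j → Walk (asGraph G) u v j → 1 ≤ j
  shortest {u} a zero nil = ⊥-elim (subst T (irrefl G u) a)
  shortest a (suc j) _ = s≤s z≤n

dist-1⇒adjacent : (Γ : Graph) {u v : V Γ} → Dist Γ u v 1 → E Γ u v
dist-1⇒adjacent Γ (cons e nil , _) = e

isometric⇒induced : {G : FinGraph} {H : Subgraph G} → Isometric H →
  ∀ {u v} (hu : T (VH H u)) (hv : T (VH H v)) → T (adj G u v) → T (EH H u v)
isometric⇒induced {G} {H} iso hu hv a =
  dist-1⇒adjacent (subGraph H) (proj₂ (iso _ _ hu hv 1) (adjacent⇒dist-1 G a))

module Retraction {G : FinGraph} {H : Subgraph G} (iso : Isometric H)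
  {x : Fin (n G)} (hx : T (VH H x)) (gate : ∀ w → InBoundary H w → w ≡ x) where

  inside-≡ : ∀ {u v} {hu : T (VH H u)} {hv : T (VH H v)} → u ≡ v →
    _≡_ {A = V (subGraph H)} (u , hu) (v , hv)
  inside-≡ refl = cong (_ ,_) (T-irrelevant _ _)

  retract : Fin (n G) → V (subGraph H)
  retract v with T? (VH H v)
  ... | yes hv = v , hv
  ... | no _ = x , hx

  retract-inside : ∀ {v} (hv : T (VH H v)) → retract v ≡ (v , hv)
  retract-inside {v} hv with T? (VH H v)
  ... | yes _ = inside-≡ refl
  ... | no ¬hv = ⊥-elim (¬hv hv)

  retract-outside : ∀ {v} → VH H v ≡ false → retract v ≡ (x , hx)
  retract-outside {v} out with T? (VH H v)
  ... | yes hv = ⊥-elim (subst T out hv)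
  ... | no _ = refl

  crossing-at-gate : ∀ {u w} → T (VH H u) → VH H w ≡ false → T (adj G u w) → u ≡ x
  crossing-at-gate {u} {w} hu out a = gate u (hu , w , a , out)

  entry-at-gate : ∀ {u w} → ¬ T (VH H u) → T (VH H w) → Move (asGraph G) u w → w ≡ x
  entry-at-gate ¬hu hw (inj₁ refl) = ⊥-elim (¬hu hw)
  entry-at-gate {u} {w} ¬hu hw (inj₂ a) =
    crossing-at-gate hw (¬T⇒≡false ¬hu) (subst T (FinGraph.sym G u w) a)

  retract-step : ∀ {u w} → Move (asGraph G) u w → Move (subGraph H) (retract u) (retract w)
  retract-step (inj₁ refl) = inj₁ refl
  retract-step {u} {w} (inj₂ a) with T? (VH H u) | T? (VH H w)
  ... | yes hu | yes hw = inj₂ (isometric⇒induced {H = H} iso hu hw a)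
  ... | yes hu | no ¬hw = inj₁ (inside-≡ (sym (crossing-at-gate hu (¬T⇒≡false ¬hw) a)))
  ... | no ¬hu | yes hw = inj₁ (inside-≡ (entry-at-gate ¬hu hw (inj₂ a)))
  ... | no _ | no _ = inj₁ refl

module Shadowing {G : FinGraph} {H : Subgraph G} {k m : ℕ}
  (σ : Strategy (asGraph G) k) (τ : Strategy (subGraph H) m) where

  record Shadows (t : ℕ) : Set where
    field
      occupied : ∀ {v} hv → (∃ λ i → pos σ t i ≡ v) → ∃ λ j → pos τ t j ≡ (v , hv)
      traversed : ∀ {v w} hv hw → (∃ λ i → pos σ t i ≡ v × pos σ (suc t) i ≡ w) →
        ∃ λ j → pos τ t j ≡ (v , hv) × pos τ (suc t) j ≡ (w , hw)
  open Shadows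

  earlier : ∀ {t} → (∀ s → s ≤ suc t → Shadows s) → ∀ s → s ≤ t → Shadows s
  earlier {t} sh s s≤t = sh s (≤-trans s≤t (n≤1+n t))

  shadowed-contamination : ∀ t → (∀ s → s ≤ t → Shadows s) →
    ∀ {v} hv → Contaminated τ t (v , hv) → Contaminated σ t v
  shadowed-contamination zero sh hv free = free ∘ occupied (sh 0 z≤n) hv
  shadowed-contamination (suc t) sh hv (free , inj₁ c) =
    free ∘ occupied (sh (suc t) ≤-refl) hv , inj₁ (shadowed-contamination t (earlier sh) hv c)
  shadowed-contamination (suc t) sh {v} hv (free , inj₂ ((w , hw) , cw , e , ¬vw , ¬wv)) =
    free ∘ occupied (sh (suc t) ≤-refl) hv ,
    inj₂ (w , shadowed-contamination t (earlier sh) hw cw , proj₂ (proj₂ (EH⊆ H v w e)) ,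
          ¬vw ∘ traversed (sh t (n≤1+n t)) hv hw , ¬wv ∘ traversed (sh t (n≤1+n t)) hw hv)

visited-or-contaminated : ∀ {Γ k} → DecidableEquality (V Γ) → (σ : Strategy Γ k) (v : V Γ) → ∀ t →
  (∃ λ s → s ≤ t × ∃ λ i → pos σ s i ≡ v) ⊎ Contaminated σ t v
visited-or-contaminated _≟_ σ v zero with any? (λ i → pos σ 0 i ≟ v)
... | yes occ = inj₁ (0 , z≤n , occ)
... | no free = inj₂ free
visited-or-contaminated _≟_ σ v (suc t) with visited-or-contaminated _≟_ σ v t
... | inj₁ (s , s≤t , occ) = inj₁ (s , ≤-trans s≤t (n≤1+n t) , occ)
... | inj₂ c with any? (λ i → pos σ (suc t) i ≟ v)
...   | yes occ = inj₁ (suc t , ≤-refl , occ)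
...   | no free = inj₂ (free , inj₁ c)

module Compression {G : FinGraph} {H : Subgraph G} (iso : Isometric H)
  {x : Fin (n G)} (hx : T (VH H x)) (gate : ∀ w → InBoundary H w → w ≡ x)
  {k : ℕ} (σ : Strategy (asGraph G) k) (m : ℕ) where

  open Retraction {H = H} iso hx gate
  open Registers {k}
  open Shadowing {H = H} {m = m} σ

  inside : ℕ → Fin k → Bool
  inside t i = VH H (pos σ t i)

  atGate : ℕ → Fin k → Bool
  atGate t i = ⌊ pos σ t i ≟ᶠ x ⌋

  lionsIn≡count : ∀ t → lionsIn H σ t ≡ count (inside t)
  lionsIn≡count t = cong sum (map-tabulate (λ i → i) (λ i → if inside t i then 1 else 0))

  -- Only lions standing at x are newly registered, so that no lion of H ever jumps;
  -- every lion entering V_H does so at x, which is why that suffices (tracked-suc).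
  register : ℕ → Register m
  register zero = trackAll (inside 0) empty
  register (suc t) = trackAll (atGate (suc t)) (restrict (inside (suc t)) (register t))

  survivors : ℕ → Register m
  survivors t = restrict (inside (suc t)) (register t)

  register-unique : ∀ t → Unique (register t)
  register-unique zero = trackAll-unique (inside 0) empty empty-unique
  register-unique (suc t) = trackAll-unique (atGate (suc t)) (survivors t) survivors-unique
    where
    survivors-unique : Unique (survivors t)
    survivors-unique = restrict-unique (inside (suc t)) (register t) (register-unique t)

  slotPos : ℕ → Maybe (Fin k) → V (subGraph H)
  slotPos t nothing = x , hx
  slotPos t (just i) = retract (pos σ t i)

  posH : ℕ → Fin m → V (subGraph H)
  posH t j = slotPos t (lookup (register t) j)

  posH-suc : ∀ t j → posH (suc t) j ≡ slotPos (suc t) (lookup (register t) j)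
  posH-suc t j = trans
    (FillsFree-invisible (slotPos (suc t)) at-gate
      (trackAll-fills (atGate (suc t)) (survivors t)) j)
    (restrict-invisible (slotPos (suc t)) (inside (suc t)) retract-outside (register t) j)
    where
    at-gate : ∀ {i} → T (atGate (suc t) i) → retract (pos σ (suc t) i) ≡ (x , hx)
    at-gate g = trans (cong retract (toWitness g)) (retract-inside hx)

  slotPos-step : ∀ t c → Move (subGraph H) (slotPos t c) (slotPos (suc t) c)
  slotPos-step t nothing = inj₁ refl
  slotPos-step t (just i) = retract-step (moves σ t i)

  σH : Strategy (subGraph H) m
  σH = record
    { pos = posH
    ; moves = λ t j → subst (Move (subGraph H) (posH t j))
                            (sym (posH-suc t j)) (slotPos-step t (lookup (register t) j)) }

  Tracked : ℕ → Set
  Tracked t = ∀ i → T (inside t i) → i ∈ᴿ register t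

  tracked-zero : count (inside 0) ≤ m → Tracked 0
  tracked-zero bound i =
    trackAll-covers (inside 0) empty (λ h → h) (empty-satisfies {m = m} {Q = inside 0})
      empty-unique bound

  tracked-suc : ∀ t → Tracked t → count (inside (suc t)) ≤ m → Tracked (suc t)
  tracked-suc t tracked bound i hi with T? (inside t i)
  ... | yes hi₀ with tracked i hi₀
  ...   | j , l = j , FillsFree-keep (trackAll-fills (atGate (suc t)) (survivors t))
                                     (restrict-keep (inside (suc t)) (register t) l hi)
  tracked-suc t tracked bound i hi | no ¬hi₀ =
    trackAll-covers (atGate (suc t)) (survivors t) gate-inside
      (restrict-satisfies (inside (suc t)) (register t))
      (restrict-unique (inside (suc t)) (register t) (register-unique t)) bound
      (fromWitness (entry-at-gate ¬hi₀ hi (moves σ t i)))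
    where
    gate-inside : ∀ {i} → T (atGate (suc t) i) → T (inside (suc t) i)
    gate-inside g = subst (T ∘ VH H) (sym (toWitness g)) hx

  tracked-upTo : ∀ {Tm} → (∀ t → t ≤ Tm → count (inside t) ≤ m) → ∀ t → t ≤ Tm → Tracked t
  tracked-upTo bound zero t≤ = tracked-zero (bound 0 t≤)
  tracked-upTo bound (suc t) t≤ =
    tracked-suc t (tracked-upTo bound t (≤-trans (n≤1+n t) t≤)) (bound (suc t) t≤)

  tracked⇒shadows : ∀ t → Tracked t → Shadows σH t
  tracked⇒shadows t tracked = record { occupied = occupied ; traversed = traversed }
    where
    occupied : ∀ {v} hv → (∃ λ i → pos σ t i ≡ v) → ∃ λ j → posH t j ≡ (v , hv)
    occupied hv (i , refl) with tracked i hv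
    ... | j , l = j , trans (cong (slotPos t) l) (retract-inside hv)
    traversed : ∀ {v w} hv hw → (∃ λ i → pos σ t i ≡ v × pos σ (suc t) i ≡ w) →
      ∃ λ j → posH t j ≡ (v , hv) × posH (suc t) j ≡ (w , hw)
    traversed hv hw (i , refl , refl) with tracked i hv
    ... | j , l = j , trans (cong (slotPos t) l) (retract-inside hv)
                    , trans (posH-suc t j) (trans (cong (slotPos (suc t)) l) (retract-inside hw))

  σH-clears : ∀ Tm → (∀ v → ¬ Contaminated σ Tm v) → (∀ t → t ≤ Tm → count (inside t) ≤ m) →
    Clears σH
  σH-clears Tm cleared bound = Tm , λ (v , hv) → cleared v ∘ shadowed-contamination σH Tm shadows hv
    where
    shadows : ∀ t → t ≤ Tm → Shadows σH t
    shadows t t≤ = tracked⇒shadows t (tracked-upTo bound t t≤)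

  cleared⇒inside-once : ∀ Tm → (∀ v → ¬ Contaminated σ Tm v) → ∃ λ t → t ≤ Tm × 1 ≤ count (inside t)
  cleared⇒inside-once Tm cleared with visited-or-contaminated _≟ᶠ_ σ x Tm
  ... | inj₁ (t , t≤ , i , e) = t , t≤ , T⇒1≤count (inside t) (subst (T ∘ VH H) (sym e) hx)
  ... | inj₂ c = ⊥-elim (cleared x c)

lemma10 : (G : FinGraph) (H : Subgraph G) → Isometric H → BoundarySize1 H →
    (ℓ : ℕ) → IsLionNumber (subGraph H) ℓ →
    (k : ℕ) → 1 ≤ k → (σ : Strategy (asGraph G) k) → Clears σ →
    ∃ λ (t : ℕ) → ℓ ≤ lionsIn H σ t
lemma10 G H iso (x , (hx , _) , gate) ℓ (_ , minimal) k _ σ (Tm , cleared)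
  with t , m≡lions ← maxUpTo-attained (lionsIn H σ) Tm =
  t , subst (ℓ ≤_) m≡lions (minimal m 1≤m σH (σH-clears Tm cleared bound))
  where
  m : ℕ
  m = maxUpTo (lionsIn H σ) Tm
  open Compression {H = H} iso hx gate σ m
  bound : ∀ t → t ≤ Tm → count (inside t) ≤ m
  bound t t≤ = subst (_≤ m) (lionsIn≡count t) (≤-maxUpTo (lionsIn H σ) t≤)
  1≤m : 1 ≤ m
  1≤m = let t , t≤ , 1≤ = cleared⇒inside-once Tm cleared in ≤-trans 1≤ (bound t t≤)
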